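{- Let $m\geqslant 3$ and let $c_1,\dots,c_m$ be positive integers with $\gcd(c_1,\dots,c_m)=1$. Then for a positive integer $N$, $\mathfrak{S}_{c_1,\dots,c_m}(N)\neq 0$ if and only if $c_1+\dots+c_m+N\equiv 0\pmod 2$ and, for every $i\in\{1,\dots,m\}$, the greatest common divisor of the $m$ numbers obtained from $c_1,\dots,c_m$ by replacing $c_i$ with $N$ equals $1$, i.e. $\gcd(c_1,\dots,c_{i-1},N,c_{i+1},\dots,c_m)=1$. Moreover, there is a constant $\kappa>0$ depending only on $c_1,\dots,c_m$ (and $m$) such that $\mathfrak{S}_{c_1,\dots,c_m}(N)\geqslant\kappa$ for every $N$ with $\mathfrak{S}_{c_1,\dots,c_m}(N)\neq 0$.
   Context: $\mathfrak{S}_{c_1,\dots,c_m}(N)=\prod_{p\mid N}\bigl(1+(p-1)\prod_{i=1}^m\frac{\mu(p/(c_i,p))}{\varphi(p/(c_i,p))}\bigr)\prod_{p\nmid N}\bigl(1-\prod_{i=1}^m\frac{\mu(p/(c_i,p))}{\varphi(p/(c_i,p))}\bigr)$, products over primes $p$; $\mu$ is the Möbius function, $\varphi$ Euler's totient, $(c,p)$ the gcd. -}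

module Defs where

open import Data.Nat as ℕ using (ℕ; zero; suc; _≤_; _∸_)
open import Data.Nat.Divisibility using (_∣_; _∣?_)
open import Data.Nat.GCD using (gcd)
open import Data.Nat.Primality using (prime?)
open import Data.Nat.DivMod using (_/_)
open import Data.Integer as ℤ using (ℤ; +_)
open import Data.Rational as ℚ using (ℚ; 0ℚ; 1ℚ)
open import Data.Fin using (Fin; zero; suc; _≟_)
open import Data.List using (List; filter; length; upTo; map; foldr)
open import Data.List.Relation.Unary.Any using (any?)
open import Data.Bool using (if_then_else_)
open import Relation.Nullary.Decidable using (does; _×-dec_)
open import Data.Product using (Σ; ∃; _×_; _,_)

φ : ℕ → ℕ
φ n = length (filter (λ k → gcd k n ℕ.≟ 1) (map suc (upTo n)))

-1^_ : ℕ → ℤ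
-1^ zero = + 1
-1^ suc k = ℤ.- (-1^ k)

-- Möbius function: μ(n) = 0 if d² ∣ n for some d ≥ 2,
-- otherwise (-1)^(number of primes dividing n).  (μ 0 = 0, never used.)
μ : ℕ → ℤ
μ zero = + 0
μ n@(suc _) =
  if does (any? (λ d → (suc (suc d) ℕ.* suc (suc d)) ∣? n) (upTo n))
  then + 0
  else (-1^ length (filter (λ p → prime? p ×-dec (p ∣? n)) (upTo (suc n))))

-- natural-number quotient a / b (b = 0 gives 0; only used with b = gcd(c,p) ≥ 1)
_div_ : ℕ → ℕ → ℕ
a div zero = 0
a div suc k = a / suc k

-- the rational z / n (n = 0 gives 0; only used with n = φ(...) ≥ 1)
frac : ℤ → ℕ → ℚ
frac z zero = 0ℚ
frac z (suc n) = z ℚ./ suc n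

ℕtoℚ : ℕ → ℚ
ℕtoℚ n = + n ℚ./ 1

sumFin : ∀ {m} → (Fin m → ℕ) → ℕ
sumFin {zero} f = 0
sumFin {suc m} f = f zero ℕ.+ sumFin (λ i → f (suc i))

prodFinℚ : ∀ {m} → (Fin m → ℚ) → ℚ
prodFinℚ {zero} f = 1ℚ
prodFinℚ {suc m} f = f zero ℚ.* prodFinℚ (λ i → f (suc i))

gcdAll : ∀ {m} → (Fin m → ℕ) → ℕ
gcdAll {zero} c = 0
gcdAll {suc m} c = gcd (c zero) (gcdAll (λ i → c (suc i)))

replaceAt : ∀ {m} → (Fin m → ℕ) → Fin m → ℕ → (Fin m → ℕ)
replaceAt c i N j = if does (j ≟ i) then N else c j

term : ℕ → ℕ → ℚ
term c p = frac (μ (p div gcd c p)) (φ (p div gcd c p))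

innerProd : ∀ {m} → (Fin m → ℕ) → ℕ → ℚ
innerProd c p = prodFinℚ (λ i → term (c i) p)

localFactor : ∀ {m} → (Fin m → ℕ) → ℕ → ℕ → ℚ
localFactor c N p =
  if does (p ∣? N)
  then 1ℚ ℚ.+ ℕtoℚ (p ∸ 1) ℚ.* innerProd c p
  else 1ℚ ℚ.- innerProd c p

primesUpTo : ℕ → List ℕ
primesUpTo X = filter prime? (upTo (suc X))

partialS : ∀ {m} → (Fin m → ℕ) → ℕ → ℕ → ℚ
partialS c N X = foldr ℚ._*_ 1ℚ (map (localFactor c N) (primesUpTo X))

-- 𝔖_c(N) is the (real) limit of partialS c N X as X → ∞.  Since ℝ is not
-- available, we state properties of this limit through the sequence:

-- 𝔖_c(N) = 0
SZero : ∀ {m} → (Fin m → ℕ) → ℕ → Set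
SZero c N = ∀ (ε : ℚ) → 0ℚ ℚ.< ε →
  ∃ λ X₀ → ∀ X → X₀ ≤ X → ℚ.∣ partialS c N X ∣ ℚ.≤ ε

-- 𝔖_c(N) ≥ κ
SGeq : ∀ {m} → (Fin m → ℕ) → ℕ → ℚ → Set
SGeq c N κ = ∀ (ε : ℚ) → 0ℚ ℚ.< ε →
  ∃ λ X₀ → ∀ X → X₀ ≤ X → κ ℚ.- ε ℚ.≤ partialS c N X

-- At a prime p put t = μ(p)/φ(p) = -1/(p-1) and let k ≥ 1 be the number of c_i not divisible
-- by p (k = 0 would make p divide every c_i).  Since (p-1) t = -1, the local factor at p is
-- 1 - t^e with e = k - [p ∣ N].  For p ≥ 3 it vanishes exactly when e = 0, i.e. when p divides
-- N and all c_j but one, i.e. when p divides one of the gcds with c_i replaced by N; otherwise it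
-- is at least 1/2.  At p = 2 we have t = -1, and the factor is 0 or 2 according as e is even or
-- odd, that is, as S + N is odd or even (S = c_1 + ... + c_m, and e ≡ S + N + 1 mod 2).  A
-- vanishing factor kills all later partial products.  Otherwise every factor is at least 1/2,
-- and for p > S + 2 we have k = m ≥ 3, so e ≥ 2 and the factor is at least 1 - 1/(p-1)^2; as
-- the product of the 1 - 1/x^2 telescopes, the partial products stay above 2^-(S+3).

module Submission where

open import Defs
open import Data.Nat using (ℕ; _≤_; _<_; _+_)
open import Data.Nat.Divisibility using (_∣_)
open import Data.Fin using (Fin)
open import Data.Rational using (ℚ; 0ℚ) renaming (_<_ to _<ℚ_)
open import Data.Product using (Σ; ∃; _×_)
open import Relation.Binary.PropositionalEquality using (_≡_)
open import Relation.Nullary using (¬_)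
open import Function.Bundles using (_⇔_)

open import Data.Nat as ℕ using (zero; suc; _*_; _∸_; _⊔_; z≤n; s≤s; _≤′_; ≤′-refl; ≤′-step)
open import Data.Nat.Properties as ℕP using ()
open import Data.Nat.Divisibility using (_∣?_; divides; ∣-refl; ∣-trans; _∣0; ∣1⇒≡1; ∣⇒≤; m∣m*n; ∣m∣n⇒∣m+n; ∣m+n∣m⇒∣n; 0∣⇒≡0)
open import Data.Nat.DivMod using (n/1≡n; n/n≡1)
open import Data.Nat.GCD using (gcd; gcd[m,n]∣m; gcd[m,n]∣n; gcd-greatest)
open import Data.Nat.Coprimality using (prime⇒coprime; coprime⇒gcd≡1) renaming (sym to coprime-sym)
open import Data.Nat.Primality using (Prime; prime?; prime[2]; prime⇒nonZero; prime⇒nonTrivial; prime⇒irreducible)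
open import Data.Nat.Primality.Factorisation using (factorise)
open import Data.Nat.Solver using () renaming (module +-*-Solver to ℕSolver)
open import Data.Integer as ℤ using (+_; -[1+_]; +≤+)
open import Data.Integer.Properties as ℤP using ()
open import Data.Rational as ℚ using (1ℚ; ½; toℚᵘ)
open import Data.Rational.Properties as ℚP using ()
open import Data.Rational.Unnormalised as ℚᵘ using (mkℚᵘ; *≤*)
open import Data.Rational.Unnormalised.Properties as ℚᵘP using ()
open import Data.Rational.Solver using (module +-*-Solver)
open import Data.Fin using (zero; suc; _≟_)
open import Data.Fin.Properties using (suc-injective)
open import Data.List using ([]; _∷_; _++_; [_]; filter; length; upTo; map; foldr)
open import Data.Nat.ListAction using (product)
open import Data.List.Properties using (upTo-∷ʳ; filter-++; filter-none; filter-all; filter-accept; filter-reject; map-++; ++-identityʳ; length-map; length-upTo; map-applyUpTo; foldr-++)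
open import Data.List.Relation.Unary.All using (All; _∷_)
open import Data.List.Relation.Unary.All.Properties using (applyUpTo⁺₁)
open import Data.List.Relation.Unary.Any using (any?; satisfied)
open import Data.Bool using (if_then_else_; true; false)
open import Data.Product using (_,_; proj₁; proj₂)
open import Data.Sum using (_⊎_; inj₁; inj₂)
open import Function using (_∘_; mk⇔)
open import Relation.Nullary using (contradiction; yes; no; does; Dec)
open import Relation.Nullary.Decidable using (_×-dec_; dec-true; dec-false; decidable-stable)
open import Relation.Binary.PropositionalEquality using (_≢_; refl; sym; trans; cong; cong₂; subst; subst₂; module ≡-Reasoning)

infixr 8 _^_

_^_ : ℚ → ℕ → ℚ
p ^ zero = 1ℚ
p ^ suc n = p ℚ.* p ^ n

^-+ : ∀ x a b → x ^ (a + b) ≡ x ^ a ℚ.* x ^ b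
^-+ x zero    b = sym (ℚP.*-identityˡ (x ^ b))
^-+ x (suc a) b = trans (cong (x ℚ.*_) (^-+ x a b)) (sym (ℚP.*-assoc x (x ^ a) (x ^ b)))

p≤∣p∣ : ∀ p → p ℚ.≤ ℚ.∣ p ∣
p≤∣p∣ p with ℚP.≤-total p 0ℚ
... | inj₁ p≤0 = ℚP.≤-trans p≤0 (ℚP.0≤∣p∣ p)
... | inj₂ 0≤p = ℚP.≤-reflexive (sym (ℚP.0≤p⇒∣p∣≡p 0≤p))

∣p*q∣≤∣p∣ : ∀ p q → ℚ.∣ q ∣ ℚ.≤ 1ℚ → ℚ.∣ p ℚ.* q ∣ ℚ.≤ ℚ.∣ p ∣
∣p*q∣≤∣p∣ p q ∣q∣≤1 = begin
  ℚ.∣ p ℚ.* q ∣     ≡⟨ ℚP.∣p*q∣≡∣p∣*∣q∣ p q ⟩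
  ℚ.∣ p ∣ ℚ.* ℚ.∣ q ∣ ≤⟨ ℚP.*-monoˡ-≤-nonNeg ℚ.∣ p ∣ {{ℚP.∣-∣-nonNeg p}} ∣q∣≤1 ⟩
  ℚ.∣ p ∣ ℚ.* 1ℚ     ≡⟨ ℚP.*-identityʳ _ ⟩
  ℚ.∣ p ∣           ∎
  where open ℚP.≤-Reasoning

∣p^n∣≤1 : ∀ p n → ℚ.∣ p ∣ ℚ.≤ 1ℚ → ℚ.∣ p ^ n ∣ ℚ.≤ 1ℚ
∣p^n∣≤1 p zero    _     = ℚP.≤-refl
∣p^n∣≤1 p (suc n) ∣p∣≤1 = ℚP.≤-trans (∣p*q∣≤∣p∣ p _ (∣p^n∣≤1 p n ∣p∣≤1)) ∣p∣≤1

p^n≤1 : ∀ p n → ℚ.∣ p ∣ ℚ.≤ 1ℚ → p ^ n ℚ.≤ 1ℚ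
p^n≤1 p n ∣p∣≤1 = ℚP.≤-trans (p≤∣p∣ _) (∣p^n∣≤1 p n ∣p∣≤1)

p^suc[n]≤∣p∣ : ∀ p n → ℚ.∣ p ∣ ℚ.≤ 1ℚ → p ^ suc n ℚ.≤ ℚ.∣ p ∣
p^suc[n]≤∣p∣ p n ∣p∣≤1 = ℚP.≤-trans (p≤∣p∣ _) (∣p*q∣≤∣p∣ p _ (∣p^n∣≤1 p n ∣p∣≤1))

p≤p+q : ∀ p {q} → 0ℚ ℚ.≤ q → p ℚ.≤ p ℚ.+ q
p≤p+q p {q} 0≤q = subst (ℚ._≤ p ℚ.+ q) (ℚP.+-identityʳ p) (ℚP.+-monoʳ-≤ p 0≤q)

p-q≤p : ∀ p {q} → 0ℚ ℚ.≤ q → p ℚ.- q ℚ.≤ p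
p-q≤p p {q} 0≤q = subst (p ℚ.- q ℚ.≤_) (ℚP.+-identityʳ p) (ℚP.+-monoʳ-≤ p (ℚP.neg-antimono-≤ 0≤q))

0≤½ : 0ℚ ℚ.≤ ½
0≤½ = ℚ.*≤* (+≤+ z≤n)

0≤1 : 0ℚ ℚ.≤ 1ℚ
0≤1 = ℚ.*≤* (+≤+ z≤n)

0<1 : 0ℚ <ℚ 1ℚ
0<1 = ℚ.*<* (ℤ.+<+ (s≤s z≤n))

½≤1 : ½ ℚ.≤ 1ℚ
½≤1 = ℚ.*≤* (+≤+ (s≤s z≤n))

½<1 : ½ <ℚ 1ℚ
½<1 = ℚ.*<* (ℤ.+<+ (s≤s (s≤s z≤n)))

0≤-*-0≤ : ∀ {p q} → 0ℚ ℚ.≤ p → 0ℚ ℚ.≤ q → 0ℚ ℚ.≤ p ℚ.* q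
0≤-*-0≤ {p} {q} 0≤p 0≤q = ℚP.nonNegative⁻¹ _ {{ℚP.nonNeg*nonNeg⇒nonNeg p {{ℚ.nonNegative 0≤p}} q {{ℚ.nonNegative 0≤q}}}}

0<½^n : ∀ n → 0ℚ ℚ.< ½ ^ n
0<½^n zero    = 0<1
0<½^n (suc n) = ℚP.positive⁻¹ _ {{ℚP.pos*pos⇒pos ½ (½ ^ n) {{ℚ.positive (0<½^n n)}}}}

½≤1-p^suc : ∀ p n → ℚ.∣ p ∣ ℚ.≤ ½ → ½ ℚ.≤ 1ℚ ℚ.- p ^ suc n
½≤1-p^suc p n ∣p∣≤½ = begin
  ½              ≡⟨ refl ⟩
  1ℚ ℚ.- ½       ≤⟨ ℚP.+-monoʳ-≤ 1ℚ (ℚP.neg-antimono-≤ (ℚP.≤-trans (p^suc[n]≤∣p∣ p n ∣p∣≤1) ∣p∣≤½)) ⟩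
  1ℚ ℚ.- p ^ suc n ∎
  where
  open ℚP.≤-Reasoning
  ∣p∣≤1 = ℚP.≤-trans ∣p∣≤½ ½≤1

x²-1≤x²[1-t^[2+n]] : ∀ x t n → x ℚ.* t ≡ ℚ.- 1ℚ → ℚ.∣ t ∣ ℚ.≤ 1ℚ →
                     x ℚ.* x ℚ.- 1ℚ ℚ.≤ x ℚ.* x ℚ.* (1ℚ ℚ.- t ^ (2 + n))
x²-1≤x²[1-t^[2+n]] x t n x*t≡-1 ∣t∣≤1 = begin
  x ℚ.* x ℚ.- 1ℚ                                ≤⟨ ℚP.+-monoʳ-≤ (x ℚ.* x) (ℚP.neg-antimono-≤ (p^n≤1 t n ∣t∣≤1)) ⟩
  x ℚ.* x ℚ.- t ^ n                             ≡⟨ solve 2 (λ x u → x :* x :- u := x :* x :- (:- con 1ℚ) :* (:- con 1ℚ) :* u) refl x (t ^ n) ⟩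
  x ℚ.* x ℚ.- (ℚ.- 1ℚ) ℚ.* (ℚ.- 1ℚ) ℚ.* t ^ n    ≡⟨ cong (λ y → x ℚ.* x ℚ.- y ℚ.* y ℚ.* t ^ n) x*t≡-1 ⟨
  x ℚ.* x ℚ.- (x ℚ.* t) ℚ.* (x ℚ.* t) ℚ.* t ^ n
    ≡⟨ solve 3 (λ x t u → x :* x :- (x :* t) :* (x :* t) :* u := x :* x :* (con 1ℚ :- t :* (t :* u))) refl x t (t ^ n) ⟩
  x ℚ.* x ℚ.* (1ℚ ℚ.- t ^ (2 + n))              ∎
  where
  open ℚP.≤-Reasoning
  open +-*-Solver

ℕtoℚ-suc : ∀ n → ℕtoℚ (suc n) ≡ 1ℚ ℚ.+ ℕtoℚ n
ℕtoℚ-suc n = ℚP.toℚᵘ-injective (ℚᵘP.≃-sym (begin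
  toℚᵘ (1ℚ ℚ.+ ℕtoℚ n)          ≈⟨ ℚP.toℚᵘ-homo-+ 1ℚ (ℕtoℚ n) ⟩
  ℚᵘ.1ℚᵘ ℚᵘ.+ toℚᵘ (ℕtoℚ n)     ≈⟨ ℚᵘP.+-congʳ ℚᵘ.1ℚᵘ (ℚP.toℚᵘ-fromℚᵘ (mkℚᵘ (+ n) 0)) ⟩
  ℚᵘ.1ℚᵘ ℚᵘ.+ mkℚᵘ (+ n) 0      ≈⟨ ℚᵘ.*≡* (cong (ℤ._* + 1) (cong (ℤ._+_ (+ 1)) (ℤP.*-identityʳ (+ n)))) ⟩
  mkℚᵘ (+ suc n) 0              ≈⟨ ℚᵘP.≃-sym (ℚP.toℚᵘ-fromℚᵘ (mkℚᵘ (+ suc n) 0)) ⟩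
  toℚᵘ (ℕtoℚ (suc n))           ∎))
  where open ℚᵘP.≃-Reasoning

0≤ℕtoℚ : ∀ n → 0ℚ ℚ.≤ ℕtoℚ n
0≤ℕtoℚ n = ℚP.nonNegative⁻¹ _ {{ℚP.normalize-nonNeg n 1}}

0<ℕtoℚ : ∀ n → 0ℚ ℚ.< ℕtoℚ (suc n)
0<ℕtoℚ n = ℚP.positive⁻¹ _ {{ℚP.normalize-pos (suc n) 1}}

prime-2+r : ∀ {p} → Prime p → ∃ λ r → p ≡ 2 + r
prime-2+r {suc (suc r)} _ = r , refl
prime-2+r {0} pp = contradiction (prime⇒nonZero pp) λ ()
prime-2+r {1} pp = contradiction (prime⇒nonTrivial pp) λ ()

prime∤1 : ∀ {p} → Prime p → ¬ p ∣ 1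
prime∤1 pp p∣1 = ℕ.nonTrivial⇒≢1 {{prime⇒nonTrivial pp}} (∣1⇒≡1 p∣1)

gcd≡p : ∀ {p} c → Prime p → p ∣ c → gcd c p ≡ p
gcd≡p {p} c pp p∣c with prime⇒irreducible pp (gcd[m,n]∣n c p)
... | inj₂ g≡p = g≡p
... | inj₁ g≡1 = contradiction (subst (p ∣_) g≡1 (gcd-greatest p∣c ∣-refl)) (prime∤1 pp)

gcd≡1 : ∀ {p} c → Prime p → ¬ p ∣ c → gcd c p ≡ 1
gcd≡1 {p} c pp p∤c with prime⇒irreducible pp (gcd[m,n]∣n c p)
... | inj₁ g≡1 = g≡1
... | inj₂ g≡p = contradiction (subst (_∣ c) g≡p (gcd[m,n]∣m c p)) p∤c

∃prime∣ : ∀ {n} → n ≢ 0 → n ≢ 1 → ∃ λ p → Prime p × p ∣ n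
∃prime∣ {0} n≢0 _ = contradiction refl n≢0
∃prime∣ {1} _ n≢1 = contradiction refl n≢1
∃prime∣ {n@(suc (suc _))} _ n≢1 with factorise n
... | record { factors = [] ; isFactorisation = n≡1 } = contradiction n≡1 n≢1
... | record { factors = p ∷ ps ; isFactorisation = n≡p*ps ; factorsPrime = pp ∷ _ } =
  p , pp , divides (product ps) (trans n≡p*ps (ℕP.*-comm p (product ps)))

prime-squarefree : ∀ {p} d → Prime p → ¬ (2 + d) * (2 + d) ∣ p
prime-squarefree {p} d pp n*n∣p with prime⇒irreducible pp (∣-trans (m∣m*n {2 + d} (2 + d)) n*n∣p)
... | inj₁ ()
... | inj₂ refl = ℕP.<⇒≱ (ℕP.m<m*n p p (ℕ.nonTrivial⇒n>1 p {{prime⇒nonTrivial pp}})) (∣⇒≤ {{prime⇒nonZero pp}} n*n∣p)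

primeDivisors-prime : ∀ {p} → Prime p → filter (λ d → prime? d ×-dec d ∣? p) (upTo (suc p)) ≡ [ p ]
primeDivisors-prime {p} pp = begin
  filter P? (upTo (suc p))            ≡⟨ cong (filter P?) (upTo-∷ʳ p) ⟨
  filter P? (upTo p ++ [ p ])         ≡⟨ filter-++ P? (upTo p) [ p ] ⟩
  filter P? (upTo p) ++ filter P? [ p ] ≡⟨ cong₂ _++_ (filter-none P? noneBelow) (filter-accept P? {xs = []} (pp , ∣-refl)) ⟩
  [ p ]                               ∎
  where
  open ≡-Reasoning
  P? = λ d → prime? d ×-dec d ∣? p
  noneBelow : All (λ d → ¬ (Prime d × d ∣ p)) (upTo p)
  noneBelow = applyUpTo⁺₁ (λ d → d) p notPrimeDivisor
    where
    notPrimeDivisor : ∀ {d} → d < p → ¬ (Prime d × d ∣ p)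
    notPrimeDivisor {d} d<p (d-prime , d∣p) with prime⇒irreducible pp d∣p
    ... | inj₁ refl = prime∤1 d-prime ∣-refl
    ... | inj₂ refl = ℕP.<-irrefl refl d<p

μ-prime : ∀ {p} → Prime p → μ p ≡ -[1+ 0 ]
μ-prime {p@(suc _)} pp = begin
  μ p                                ≡⟨ cong (λ b → if b then + 0 else -1^ length primeDivisors) squarefree ⟩
  -1^ length primeDivisors           ≡⟨ cong (λ ds → -1^ length ds) (primeDivisors-prime pp) ⟩
  -[1+ 0 ]                           ∎
  where
  open ≡-Reasoning
  primeDivisors = filter (λ d → prime? d ×-dec d ∣? p) (upTo (suc p))
  squarefree = dec-false (any? (λ d → (2 + d) * (2 + d) ∣? p) (upTo p))
                         (λ square∣p → let d , sq = satisfied square∣p in prime-squarefree d pp sq)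

φ-prime : ∀ {q} → Prime (suc q) → φ (suc q) ≡ q
φ-prime {q} pp = begin
  length (filter C? (map suc (upTo (suc q))))             ≡⟨ cong (λ ks → length (filter C? (map suc ks))) (upTo-∷ʳ q) ⟨
  length (filter C? (map suc (upTo q ++ [ q ])))          ≡⟨ cong (λ ks → length (filter C? ks)) (map-++ suc (upTo q) [ q ]) ⟩
  length (filter C? (map suc (upTo q) ++ [ p ]))          ≡⟨ cong length (filter-++ C? (map suc (upTo q)) [ p ]) ⟩
  length (filter C? (map suc (upTo q)) ++ filter C? [ p ])
    ≡⟨ cong₂ (λ ks ls → length (ks ++ ls)) (filter-all C? below) (filter-reject C? {x = p} {xs = []} self) ⟩
  length (map suc (upTo q) ++ [])                         ≡⟨ cong length (++-identityʳ (map suc (upTo q))) ⟩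
  length (map suc (upTo q))                               ≡⟨ length-map suc (upTo q) ⟩
  length (upTo q)                                         ≡⟨ length-upTo q ⟩
  q                                                       ∎
  where
  open ≡-Reasoning
  p = suc q
  C? = λ k → gcd k p ℕ.≟ 1
  below : All (λ k → gcd k p ≡ 1) (map suc (upTo q))
  below = subst (All _) (sym (map-applyUpTo (λ k → k) suc q))
            (applyUpTo⁺₁ suc q λ k<q → coprime⇒gcd≡1 (coprime-sym (prime⇒coprime pp (s≤s k<q))))
  self : ¬ gcd p p ≡ 1
  self gcd≡1 = prime∤1 pp (subst (p ∣_) gcd≡1 (gcd-greatest ∣-refl ∣-refl))

-- μ(p)/φ(p) at the prime p = 2 + r.
-1/[1+_] : ℕ → ℚ
-1/[1+ r ] = -[1+ 0 ] ℚ./ suc r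

ℕtoℚ*-1/[1+] : ∀ r → ℕtoℚ (suc r) ℚ.* -1/[1+ r ] ≡ ℚ.- 1ℚ
ℕtoℚ*-1/[1+] r = trans (sym (ℚP.neg-distribʳ-* (ℕtoℚ (suc r)) (+ 1 ℚ./ suc r))) (cong ℚ.-_ n*1/n≡1)
  where
  n*1/n≡1 : ℕtoℚ (suc r) ℚ.* (+ 1 ℚ./ suc r) ≡ 1ℚ
  n*1/n≡1 = ℚP.toℚᵘ-injective (begin
     toℚᵘ (ℕtoℚ (suc r) ℚ.* (+ 1 ℚ./ suc r))            ≈⟨ ℚP.toℚᵘ-homo-* (ℕtoℚ (suc r)) (+ 1 ℚ./ suc r) ⟩
     toℚᵘ (ℕtoℚ (suc r)) ℚᵘ.* toℚᵘ (+ 1 ℚ./ suc r)      ≈⟨ ℚᵘP.*-cong (ℚP.toℚᵘ-fromℚᵘ (mkℚᵘ (+ suc r) 0)) (ℚP.toℚᵘ-fromℚᵘ (mkℚᵘ (+ 1) r)) ⟩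
     mkℚᵘ (+ suc r) 0 ℚᵘ.* mkℚᵘ (+ 1) r                 ≈⟨ ℚᵘP.*-inverseʳ (mkℚᵘ (+ suc r) 0) ⟩
     ℚᵘ.1ℚᵘ                                             ∎)
    where open ℚᵘP.≃-Reasoning

∣-1/[1+r]∣≡ : ∀ r → ℚ.∣ -1/[1+ r ] ∣ ≡ + 1 ℚ./ suc r
∣-1/[1+r]∣≡ r = trans (ℚP.∣-p∣≡∣p∣ (+ 1 ℚ./ suc r)) (ℚP.0≤p⇒∣p∣≡p (ℚP.nonNegative⁻¹ _ {{ℚP.normalize-nonNeg 1 (suc r)}}))

∣-1/[1+r]∣≤1 : ∀ r → ℚ.∣ -1/[1+ r ] ∣ ℚ.≤ 1ℚ
∣-1/[1+r]∣≤1 r = subst (ℚ._≤ 1ℚ) (sym (∣-1/[1+r]∣≡ r))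
  (ℚP.toℚᵘ-cancel-≤ (ℚᵘP.≤-respˡ-≃ (ℚᵘP.≃-sym (ℚP.toℚᵘ-fromℚᵘ (mkℚᵘ (+ 1) r))) (*≤* (+≤+ (s≤s z≤n)))))

∣-1/[2+r]∣≤½ : ∀ r → ℚ.∣ -1/[1+ suc r ] ∣ ℚ.≤ ½
∣-1/[2+r]∣≤½ r = subst (ℚ._≤ ½) (sym (∣-1/[1+r]∣≡ (suc r)))
  (ℚP.toℚᵘ-cancel-≤ (ℚᵘP.≤-respˡ-≃ (ℚᵘP.≃-sym (ℚP.toℚᵘ-fromℚᵘ (mkℚᵘ (+ 1) (suc r)))) (*≤* (+≤+ (s≤s (s≤s z≤n))))))

gcdAll-∣ : ∀ {m} (c : Fin m → ℕ) i → gcdAll c ∣ c i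
gcdAll-∣ c zero    = gcd[m,n]∣m (c zero) _
gcdAll-∣ c (suc i) = ∣-trans (gcd[m,n]∣n (c zero) _) (gcdAll-∣ (λ j → c (suc j)) i)

∣-gcdAll : ∀ {m d} (c : Fin m → ℕ) → (∀ i → d ∣ c i) → d ∣ gcdAll c
∣-gcdAll {zero}  {d} c _   = d ∣0
∣-gcdAll {suc m} c d∣c = gcd-greatest (d∣c zero) (∣-gcdAll (λ i → c (suc i)) (λ i → d∣c (suc i)))

≤sumFin : ∀ {m} (c : Fin m → ℕ) i → c i ≤ sumFin c
≤sumFin c zero    = ℕP.m≤m+n (c zero) _
≤sumFin c (suc i) = ℕP.≤-trans (≤sumFin (λ j → c (suc j)) i) (ℕP.m≤n+m _ (c zero))

replaceAt-≡ : ∀ {m} (c : Fin m → ℕ) i N → replaceAt c i N i ≡ N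
replaceAt-≡ c i N = cong (if_then N else c i) (dec-true (i ≟ i) refl)

replaceAt-≢ : ∀ {m} (c : Fin m → ℕ) {i j} N → j ≢ i → replaceAt c i N j ≡ c j
replaceAt-≢ c {i} {j} N j≢i = cong (if_then N else c j) (dec-false (j ≟ i) j≢i)

∣-gcdAll-replaceAt : ∀ {m d} (c : Fin m → ℕ) i {N} → d ∣ N → (∀ j → j ≢ i → d ∣ c j) →
                     d ∣ gcdAll (replaceAt c i N)
∣-gcdAll-replaceAt {d = d} c i {N} d∣N d∣c = ∣-gcdAll (replaceAt c i N) λ j → byIndex j (j ≟ i)
  where
  byIndex : ∀ j → Dec (j ≡ i) → d ∣ replaceAt c i N j
  byIndex j (yes refl) = subst (d ∣_) (sym (replaceAt-≡ c i N)) d∣N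
  byIndex j (no j≢i)   = subst (d ∣_) (sym (replaceAt-≢ c N j≢i)) (d∣c j j≢i)

∣-gcdAll-replaceAt⁻ : ∀ {m d} (c : Fin m → ℕ) i {N} → d ∣ gcdAll (replaceAt c i N) →
                      d ∣ N × (∀ j → j ≢ i → d ∣ c j)
∣-gcdAll-replaceAt⁻ {d = d} c i {N} d∣gcd =
    subst (d ∣_) (replaceAt-≡ c i N) (∣-trans d∣gcd (gcdAll-∣ _ i))
  , λ j j≢i → subst (d ∣_) (replaceAt-≢ c N j≢i) (∣-trans d∣gcd (gcdAll-∣ _ j))

∤-indicator : ℕ → ℕ → ℕ
∤-indicator p n = if does (p ∣? n) then 0 else 1

∤-count : ∀ {m} → ℕ → (Fin m → ℕ) → ℕ
∤-count p c = sumFin (λ i → ∤-indicator p (c i))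

∤-indicator-∣ : ∀ {p n} → p ∣ n → ∤-indicator p n ≡ 0
∤-indicator-∣ {p} {n} p∣n = cong (if_then 0 else 1) (dec-true (p ∣? n) p∣n)

∤-indicator-∤ : ∀ {p n} → ¬ p ∣ n → ∤-indicator p n ≡ 1
∤-indicator-∤ {p} {n} p∤n = cong (if_then 0 else 1) (dec-false (p ∣? n) p∤n)

∤-indicator≤1 : ∀ p n → ∤-indicator p n ≤ 1
∤-indicator≤1 p n with does (p ∣? n)
... | true  = z≤n
... | false = s≤s z≤n

∤-indicator≡0⇒∣ : ∀ {p n} → ∤-indicator p n ≡ 0 → p ∣ n
∤-indicator≡0⇒∣ {p} {n} ind≡0 = decidable-stable (p ∣? n) λ p∤n → contradiction (trans (sym (∤-indicator-∤ p∤n)) ind≡0) λ ()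

∤-count≡0⇒∣ : ∀ {m p} (c : Fin m → ℕ) → ∤-count p c ≡ 0 → ∀ i → p ∣ c i
∤-count≡0⇒∣ {p = p} c count≡0 zero    = ∤-indicator≡0⇒∣ (ℕP.m+n≡0⇒m≡0 (∤-indicator p (c zero)) count≡0)
∤-count≡0⇒∣ {p = p} c count≡0 (suc i) = ∤-count≡0⇒∣ (λ j → c (suc j)) (ℕP.m+n≡0⇒n≡0 (∤-indicator p (c zero)) count≡0) i

∣-all⇒∤-count≡0 : ∀ {m p} (c : Fin m → ℕ) → (∀ i → p ∣ c i) → ∤-count p c ≡ 0
∣-all⇒∤-count≡0 {zero}  c _   = refl
∣-all⇒∤-count≡0 {suc m} c p∣c = cong₂ _+_ (∤-indicator-∣ (p∣c zero)) (∣-all⇒∤-count≡0 (λ i → c (suc i)) (λ i → p∣c (suc i)))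

∤-all⇒∤-count≡m : ∀ {m p} (c : Fin m → ℕ) → (∀ i → ¬ p ∣ c i) → ∤-count p c ≡ m
∤-all⇒∤-count≡m {zero}  c _   = refl
∤-all⇒∤-count≡m {suc m} c p∤c = cong₂ _+_ (∤-indicator-∤ (p∤c zero)) (∤-all⇒∤-count≡m (λ i → c (suc i)) (λ i → p∤c (suc i)))

∤-count-pos : ∀ {m p} (c : Fin m → ℕ) → Prime p → gcdAll c ≡ 1 → ∃ λ j → ∤-count p c ≡ suc j
∤-count-pos {p = p} c pp gcd≡1 with ∤-count p c in count≡
... | suc j = j , refl
... | zero  = contradiction (subst (p ∣_) gcd≡1 (∣-gcdAll c (∤-count≡0⇒∣ c count≡))) (prime∤1 pp)

∤-count≡1⇒∣-except : ∀ {m p} (c : Fin m → ℕ) → ∤-count p c ≡ 1 → ∃ λ i → ∀ j → j ≢ i → p ∣ c j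
∤-count≡1⇒∣-except {zero} c ()
∤-count≡1⇒∣-except {suc m} {p} c count≡1 = byHead (p ∣? c zero)
  where
  tail = λ j → c (suc j)
  byHead : Dec (p ∣ c zero) → ∃ λ i → ∀ j → j ≢ i → p ∣ c j
  byHead (yes p∣c₀) with ∤-count≡1⇒∣-except tail (trans (cong (_+ ∤-count p tail) (sym (∤-indicator-∣ p∣c₀))) count≡1)
  ... | i , p∣except = suc i , λ where
    zero    _   → p∣c₀
    (suc j) j≢i → p∣except j (λ j≡i → j≢i (cong suc j≡i))
  byHead (no p∤c₀) = zero , λ where
    zero    0≢0 → contradiction refl 0≢0
    (suc j) _   → ∤-count≡0⇒∣ tail (ℕP.suc-injective (trans (cong (_+ ∤-count p tail) (sym (∤-indicator-∤ p∤c₀))) count≡1)) j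

∣-except⇒∤-count≤1 : ∀ {m p} (c : Fin m → ℕ) i → (∀ j → j ≢ i → p ∣ c j) → ∤-count p c ≤ 1
∣-except⇒∤-count≤1 {p = p} c zero p∣except = begin
  ∤-indicator p (c zero) + ∤-count p (λ j → c (suc j))
    ≡⟨ cong (λ k → ∤-indicator p (c zero) + k) (∣-all⇒∤-count≡0 _ (λ j → p∣except (suc j) λ ())) ⟩
  ∤-indicator p (c zero) + 0                           ≡⟨ ℕP.+-identityʳ _ ⟩
  ∤-indicator p (c zero)                               ≤⟨ ∤-indicator≤1 p (c zero) ⟩
  1                                                    ∎
  where open ℕP.≤-Reasoning
∣-except⇒∤-count≤1 {p = p} c (suc i) p∣except = begin
  ∤-indicator p (c zero) + ∤-count p (λ j → c (suc j)) ≡⟨ cong (_+ ∤-count p (λ j → c (suc j))) (∤-indicator-∣ (p∣except zero λ ())) ⟩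
  ∤-count p (λ j → c (suc j))
    ≤⟨ ∣-except⇒∤-count≤1 (λ j → c (suc j)) i (λ j j≢i → p∣except (suc j) (j≢i ∘ suc-injective)) ⟩
  1                                                    ∎
  where open ℕP.≤-Reasoning

term-∣ : ∀ {p} c → Prime p → p ∣ c → term c p ≡ 1ℚ
term-∣ c pp p∣c with prime-2+r pp
... | r , refl rewrite gcd≡p c pp p∣c | n/n≡1 (2 + r) {{_}} = refl

term-∤ : ∀ {r} c → Prime (2 + r) → ¬ 2 + r ∣ c → term c (2 + r) ≡ -1/[1+ r ]
term-∤ {r} c pp p∤c rewrite gcd≡1 c pp p∤c | n/1≡n (2 + r) | μ-prime pp | φ-prime pp = refl

term-prime : ∀ {r} c → Prime (2 + r) → term c (2 + r) ≡ -1/[1+ r ] ^ ∤-indicator (2 + r) c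
term-prime {r} c pp = byDivisibility (2 + r ∣? c)
  where
  byDivisibility : Dec (2 + r ∣ c) → term c (2 + r) ≡ -1/[1+ r ] ^ ∤-indicator (2 + r) c
  byDivisibility (yes p∣c) = trans (term-∣ c pp p∣c) (cong (-1/[1+ r ] ^_) (sym (∤-indicator-∣ p∣c)))
  byDivisibility (no p∤c)  = trans (term-∤ c pp p∤c) (trans (sym (ℚP.*-identityʳ _)) (cong (-1/[1+ r ] ^_) (sym (∤-indicator-∤ p∤c))))

innerProd-prime : ∀ {m r} (c : Fin m → ℕ) → Prime (2 + r) →
                  innerProd c (2 + r) ≡ -1/[1+ r ] ^ ∤-count (2 + r) c
innerProd-prime {zero} c pp = refl
innerProd-prime {suc m} {r} c pp = begin
  term (c zero) p ℚ.* innerProd (λ i → c (suc i)) p    ≡⟨ cong₂ ℚ._*_ (term-prime (c zero) pp) (innerProd-prime (λ i → c (suc i)) pp) ⟩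
  t ^ ∤-indicator p (c zero) ℚ.* t ^ ∤-count p (λ i → c (suc i)) ≡⟨ ^-+ t (∤-indicator p (c zero)) _ ⟨
  t ^ ∤-count p c                                      ∎
  where
  open ≡-Reasoning
  p = 2 + r
  t = -1/[1+ r ]

localFactor-∣ : ∀ {m p N} (c : Fin m → ℕ) → p ∣ N → localFactor c N p ≡ 1ℚ ℚ.+ ℕtoℚ (p ∸ 1) ℚ.* innerProd c p
localFactor-∣ {p = p} {N} c p∣N = cong (if_then _ else _) (dec-true (p ∣? N) p∣N)

localFactor-∤ : ∀ {m p N} (c : Fin m → ℕ) → ¬ p ∣ N → localFactor c N p ≡ 1ℚ ℚ.- innerProd c p
localFactor-∤ {p = p} {N} c p∤N = cong (if_then _ else _) (dec-false (p ∣? N) p∤N)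

-- With k = 1 + j non-multiples of p among the c_i, the exponent is k - [p ∣ N].
localFactor-prime : ∀ {m r j} (c : Fin m → ℕ) N → Prime (2 + r) → ∤-count (2 + r) c ≡ suc j →
                    localFactor c N (2 + r) ≡ 1ℚ ℚ.- -1/[1+ r ] ^ (∤-indicator (2 + r) N + j)
localFactor-prime {r = r} {j} c N pp count≡ = byDivisibility (2 + r ∣? N)
  where
  t = -1/[1+ r ]
  x = ℕtoℚ (suc r)
  innerProd≡ : innerProd c (2 + r) ≡ t ^ suc j
  innerProd≡ = trans (innerProd-prime c pp) (cong (t ^_) count≡)
  open ≡-Reasoning
  open +-*-Solver
  byDivisibility : Dec (2 + r ∣ N) → localFactor c N (2 + r) ≡ 1ℚ ℚ.- t ^ (∤-indicator (2 + r) N + j)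
  byDivisibility (no p∤N) = begin
    localFactor c N (2 + r)                 ≡⟨ localFactor-∤ c p∤N ⟩
    1ℚ ℚ.- innerProd c (2 + r)              ≡⟨ cong (ℚ._-_ 1ℚ) innerProd≡ ⟩
    1ℚ ℚ.- t ^ suc j                        ≡⟨ cong (λ k → 1ℚ ℚ.- t ^ (k + j)) (∤-indicator-∤ p∤N) ⟨
    1ℚ ℚ.- t ^ (∤-indicator (2 + r) N + j)  ∎
  byDivisibility (yes p∣N) = begin
    localFactor c N (2 + r)                 ≡⟨ localFactor-∣ c p∣N ⟩
    1ℚ ℚ.+ x ℚ.* innerProd c (2 + r)        ≡⟨ cong (λ k → 1ℚ ℚ.+ x ℚ.* k) innerProd≡ ⟩
    1ℚ ℚ.+ x ℚ.* (t ℚ.* t ^ j)              ≡⟨ solve 3 (λ x t u → con 1ℚ :+ x :* (t :* u) := con 1ℚ :+ (x :* t) :* u) refl x t (t ^ j) ⟩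
    1ℚ ℚ.+ (x ℚ.* t) ℚ.* t ^ j              ≡⟨ cong (λ y → 1ℚ ℚ.+ y ℚ.* t ^ j) (ℕtoℚ*-1/[1+] r) ⟩
    1ℚ ℚ.+ (ℚ.- 1ℚ) ℚ.* t ^ j               ≡⟨ solve 1 (λ u → con 1ℚ :+ (:- con 1ℚ) :* u := con 1ℚ :- u) refl (t ^ j) ⟩
    1ℚ ℚ.- t ^ j                            ≡⟨ cong (λ k → 1ℚ ℚ.- t ^ (k + j)) (∤-indicator-∣ p∣N) ⟨
    1ℚ ℚ.- t ^ (∤-indicator (2 + r) N + j)  ∎

localFactor≡0 : ∀ {m p N} (c : Fin m → ℕ) i → Prime p → gcdAll c ≡ 1 →
                p ∣ gcdAll (replaceAt c i N) → localFactor c N p ≡ 0ℚ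
localFactor≡0 {p = p} {N} c i pp gcd≡1 p∣gcd with prime-2+r pp
... | r , refl = begin
  localFactor c N p                       ≡⟨ localFactor-prime c N pp count≡1 ⟩
  1ℚ ℚ.- t ^ (∤-indicator p N + 0)        ≡⟨ cong (λ k → 1ℚ ℚ.- t ^ (k + 0)) (∤-indicator-∣ p∣N) ⟩
  0ℚ                                      ∎
  where
  open ≡-Reasoning
  t = -1/[1+ r ]
  p∣N = proj₁ (∣-gcdAll-replaceAt⁻ c i p∣gcd)
  count≡1 : ∤-count p c ≡ 1
  count≡1 with ∤-count-pos c pp gcd≡1
  ... | j , count≡ = ℕP.≤-antisym (∣-except⇒∤-count≤1 c i (proj₂ (∣-gcdAll-replaceAt⁻ c i p∣gcd)))
                                 (subst (1 ≤_) (sym count≡) (s≤s z≤n))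

2∣n⊎2∣1+n : ∀ n → 2 ∣ n ⊎ 2 ∣ suc n
2∣n⊎2∣1+n zero    = inj₁ (2 ∣0)
2∣n⊎2∣1+n (suc n) with 2∣n⊎2∣1+n n
... | inj₁ 2∣n   = inj₂ (∣m∣n⇒∣m+n (∣-refl {2}) 2∣n)
... | inj₂ 2∣1+n = inj₁ 2∣1+n

2∣n⇒2∤1+n : ∀ {n} → 2 ∣ n → ¬ 2 ∣ suc n
2∣n⇒2∤1+n {n} 2∣n 2∣1+n = prime∤1 prime[2] (∣m+n∣m⇒∣n (subst (2 ∣_) (ℕP.+-comm 1 n) 2∣1+n) 2∣n)

2∣n+∤-indicator : ∀ n → 2 ∣ n + ∤-indicator 2 n
2∣n+∤-indicator n with 2∣n⊎2∣1+n n
... | inj₁ 2∣n   = subst (λ k → 2 ∣ n + k) (sym (∤-indicator-∣ 2∣n)) (subst (2 ∣_) (sym (ℕP.+-identityʳ n)) 2∣n)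
... | inj₂ 2∣1+n = subst (λ k → 2 ∣ n + k) (sym (∤-indicator-∤ λ 2∣n → 2∣n⇒2∤1+n 2∣n 2∣1+n))
                         (subst (2 ∣_) (ℕP.+-comm 1 n) 2∣1+n)

2∣sum+∤-count : ∀ {m} (c : Fin m → ℕ) → 2 ∣ sumFin c + ∤-count 2 c
2∣sum+∤-count {zero}  c = 2 ∣0
2∣sum+∤-count {suc m} c = subst (2 ∣_) (rearrange (c zero) (sumFin tail) (∤-indicator 2 (c zero)) (∤-count 2 tail))
                               (∣m∣n⇒∣m+n (2∣n+∤-indicator (c zero)) (2∣sum+∤-count tail))
  where
  tail = λ i → c (suc i)
  open ℕSolver
  rearrange : ∀ a b x y → (a + x) + (b + y) ≡ (a + b) + (x + y)
  rearrange = solve 4 (λ a b x y → (a :+ x) :+ (b :+ y) := (a :+ b) :+ (x :+ y)) refl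

-1^-parity : ∀ e → (2 ∣ e × (ℚ.- 1ℚ) ^ e ≡ 1ℚ) ⊎ (2 ∣ suc e × (ℚ.- 1ℚ) ^ e ≡ ℚ.- 1ℚ)
-1^-parity zero = inj₁ (2 ∣0 , refl)
-1^-parity (suc e) with -1^-parity e
... | inj₁ (2∣e , even) = inj₂ (∣m∣n⇒∣m+n (∣-refl {2}) 2∣e , cong (ℚ.- 1ℚ ℚ.*_) even)
... | inj₂ (2∣1+e , odd) = inj₁ (2∣1+e , cong (ℚ.- 1ℚ ℚ.*_) odd)

localFactor₂ : ∀ {m} (c : Fin m → ℕ) N → gcdAll c ≡ 1 →
               (2 ∣ sumFin c + N × localFactor c N 2 ≡ 1ℚ ℚ.+ 1ℚ) ⊎ (¬ 2 ∣ sumFin c + N × localFactor c N 2 ≡ 0ℚ)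
localFactor₂ c N gcd≡1 with ∤-count-pos c prime[2] gcd≡1
... | j , count≡ = byParity (-1^-parity e)
  where
  S = sumFin c
  e = ∤-indicator 2 N + j
  localFactor≡ : localFactor c N 2 ≡ 1ℚ ℚ.- (ℚ.- 1ℚ) ^ e
  localFactor≡ = localFactor-prime c N prime[2] count≡
  open ℕSolver
  2∣S+N+1+e : 2 ∣ (S + N) + suc e
  2∣S+N+1+e = subst (2 ∣_) (solve 4 (λ S N i j → (S :+ (con 1 :+ j)) :+ (N :+ i) := (S :+ N) :+ (con 1 :+ (i :+ j))) refl S N (∤-indicator 2 N) j)
                (∣m∣n⇒∣m+n (subst (λ k → 2 ∣ S + k) count≡ (2∣sum+∤-count c)) (2∣n+∤-indicator N))
  byParity : (2 ∣ e × (ℚ.- 1ℚ) ^ e ≡ 1ℚ) ⊎ (2 ∣ suc e × (ℚ.- 1ℚ) ^ e ≡ ℚ.- 1ℚ) →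
             (2 ∣ S + N × localFactor c N 2 ≡ 1ℚ ℚ.+ 1ℚ) ⊎ (¬ 2 ∣ S + N × localFactor c N 2 ≡ 0ℚ)
  byParity (inj₁ (2∣e , even)) =
    inj₂ ((λ 2∣S+N → 2∣n⇒2∤1+n 2∣e (∣m+n∣m⇒∣n 2∣S+N+1+e 2∣S+N)) , trans localFactor≡ (cong (ℚ._-_ 1ℚ) even))
  byParity (inj₂ (2∣1+e , odd)) =
    inj₁ (∣m+n∣m⇒∣n (subst (2 ∣_) (ℕP.+-comm (S + N) (suc e)) 2∣S+N+1+e) 2∣1+e , trans localFactor≡ (cong (ℚ._-_ 1ℚ) odd))

localFactor₂≡2 : ∀ {m} (c : Fin m → ℕ) N → gcdAll c ≡ 1 → 2 ∣ sumFin c + N → localFactor c N 2 ≡ 1ℚ ℚ.+ 1ℚ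
localFactor₂≡2 c N gcd≡1 2∣S+N with localFactor₂ c N gcd≡1
... | inj₁ (_ , localFactor≡2) = localFactor≡2
... | inj₂ (2∤S+N , _)        = contradiction 2∣S+N 2∤S+N

localFactor₂≡0 : ∀ {m} (c : Fin m → ℕ) N → gcdAll c ≡ 1 → ¬ 2 ∣ sumFin c + N → localFactor c N 2 ≡ 0ℚ
localFactor₂≡0 c N gcd≡1 2∤S+N with localFactor₂ c N gcd≡1
... | inj₁ (2∣S+N , _)        = contradiction 2∣S+N 2∤S+N
... | inj₂ (_ , localFactor≡0) = localFactor≡0

½≤localFactor : ∀ {m p N} (c : Fin m → ℕ) → gcdAll c ≡ 1 → 2 ∣ sumFin c + N →
                (∀ i → gcdAll (replaceAt c i N) ≡ 1) → Prime p → ½ ℚ.≤ localFactor c N p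
½≤localFactor {p = p} {N} c gcd≡1 2∣S+N coprime pp with prime-2+r pp
... | zero , refl = subst (½ ℚ.≤_) (sym (localFactor₂≡2 c N gcd≡1 2∣S+N)) (ℚP.≤-trans ½≤1 (p≤p+q 1ℚ 0≤1))
... | suc r , refl with ∤-count-pos c pp gcd≡1
...   | j , count≡ = subst (½ ℚ.≤_) (sym (localFactor-prime c N pp count≡)) (byExponent (∤-indicator p N + j) refl)
  where
  byExponent : ∀ e → ∤-indicator p N + j ≡ e → ½ ℚ.≤ 1ℚ ℚ.- -1/[1+ suc r ] ^ e
  byExponent (suc e) _   = ½≤1-p^suc _ e (∣-1/[2+r]∣≤½ r)
  byExponent zero    e≡0 = contradiction (subst (p ∣_) (coprime i) (∣-gcdAll-replaceAt c i p∣N p∣except)) (prime∤1 pp)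
    where
    p∣N = ∤-indicator≡0⇒∣ (ℕP.m+n≡0⇒m≡0 _ e≡0)
    i∣except = ∤-count≡1⇒∣-except c (trans count≡ (cong suc (ℕP.m+n≡0⇒n≡0 (∤-indicator p N) e≡0)))
    i = proj₁ i∣except
    p∣except = proj₂ i∣except

localFactor-large : ∀ {m r} (c : Fin m → ℕ) N → 3 ≤ m → Prime (2 + r) → (∀ i → ¬ 2 + r ∣ c i) →
                    let x = ℕtoℚ (suc r) in x ℚ.* x ℚ.- 1ℚ ℚ.≤ x ℚ.* x ℚ.* localFactor c N (2 + r)
localFactor-large {0}     _ _ () _ _
localFactor-large {1}     _ _ (s≤s ()) _ _
localFactor-large {2}     _ _ (s≤s (s≤s ())) _ _
localFactor-large {suc (suc (suc m))} {r} c N _ pp p∤c = subst (λ k → x ℚ.* x ℚ.- 1ℚ ℚ.≤ x ℚ.* x ℚ.* k) (sym localFactor≡)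
  (x²-1≤x²[1-t^[2+n]] x -1/[1+ r ] (∤-indicator (2 + r) N + m) (ℕtoℚ*-1/[1+] r) (∣-1/[1+r]∣≤1 r))
  where
  x = ℕtoℚ (suc r)
  localFactor≡ : localFactor c N (2 + r) ≡ 1ℚ ℚ.- -1/[1+ r ] ^ (2 + (∤-indicator (2 + r) N + m))
  localFactor≡ = trans (localFactor-prime c N pp (∤-all⇒∤-count≡m c p∤c))
                       (cong (λ k → 1ℚ ℚ.- -1/[1+ r ] ^ k) (trans (ℕP.+-suc i (suc m)) (cong suc (ℕP.+-suc i m))))
    where i = ∤-indicator (2 + r) N

primeProduct : (ℕ → ℚ) → ℕ → ℚ
primeProduct f X = foldr ℚ._*_ 1ℚ (map f (primesUpTo X))

onPrimes : (ℕ → ℚ) → ℕ → ℚ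
onPrimes f n = if does (prime? n) then f n else 1ℚ

onPrimes-elim : ∀ (Q : ℚ → Set) f n → (Prime n → Q (f n)) → Q 1ℚ → Q (onPrimes f n)
onPrimes-elim Q f n Qf Q1 with prime? n
... | yes pp = Qf pp
... | no _   = Q1

onPrimes-prime : ∀ f {p} → Prime p → onPrimes f p ≡ f p
onPrimes-prime f {p} pp with prime? p
... | yes _  = refl
... | no ¬pp = contradiction pp ¬pp

foldr-*-init : ∀ xs z → foldr ℚ._*_ z xs ≡ foldr ℚ._*_ 1ℚ xs ℚ.* z
foldr-*-init []       z = sym (ℚP.*-identityˡ z)
foldr-*-init (x ∷ xs) z = trans (cong (x ℚ.*_) (foldr-*-init xs z)) (sym (ℚP.*-assoc x _ z))

primeProduct-suc : ∀ f n → primeProduct f (suc n) ≡ primeProduct f n ℚ.* onPrimes f (suc n)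
primeProduct-suc f n = begin
  foldr ℚ._*_ 1ℚ (map f (filter prime? (upTo (suc (suc n)))))            ≡⟨ cong (λ ks → foldr ℚ._*_ 1ℚ (map f (filter prime? ks))) (upTo-∷ʳ (suc n)) ⟨
  foldr ℚ._*_ 1ℚ (map f (filter prime? (upTo (suc n) ++ [ suc n ])))     ≡⟨ cong (λ ks → foldr ℚ._*_ 1ℚ (map f ks)) (filter-++ prime? (upTo (suc n)) [ suc n ]) ⟩
  foldr ℚ._*_ 1ℚ (map f (primesUpTo n ++ filter prime? [ suc n ]))       ≡⟨ cong (foldr ℚ._*_ 1ℚ) (map-++ f (primesUpTo n) (filter prime? [ suc n ])) ⟩
  foldr ℚ._*_ 1ℚ (map f (primesUpTo n) ++ map f (filter prime? [ suc n ])) ≡⟨ foldr-++ ℚ._*_ 1ℚ (map f (primesUpTo n)) _ ⟩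
  foldr ℚ._*_ lastFactor (map f (primesUpTo n))                            ≡⟨ foldr-*-init (map f (primesUpTo n)) lastFactor ⟩
  primeProduct f n ℚ.* lastFactor                                          ≡⟨ cong (primeProduct f n ℚ.*_) lastFactor≡ ⟩
  primeProduct f n ℚ.* onPrimes f (suc n)                                  ∎
  where
  open ≡-Reasoning
  lastFactor = foldr ℚ._*_ 1ℚ (map f (filter prime? [ suc n ]))
  lastFactor≡ : lastFactor ≡ onPrimes f (suc n)
  lastFactor≡ with prime? (suc n)
  ... | yes _ = ℚP.*-identityʳ (f (suc n))
  ... | no _  = refl

primeProduct≡0 : ∀ f {p n} → Prime p → f p ≡ 0ℚ → p ≤ n → primeProduct f n ≡ 0ℚ
primeProduct≡0 f pp fp≡0 p≤n with prime-2+r pp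
... | r , refl = go (ℕP.≤⇒≤′ p≤n)
  where
  q = suc r
  go : ∀ {n} → suc q ≤′ n → primeProduct f n ≡ 0ℚ
  go ≤′-refl = begin
    primeProduct f (suc q)                    ≡⟨ primeProduct-suc f q ⟩
    primeProduct f q ℚ.* onPrimes f (suc q)   ≡⟨ cong (primeProduct f q ℚ.*_) (trans (onPrimes-prime f pp) fp≡0) ⟩
    primeProduct f q ℚ.* 0ℚ                   ≡⟨ ℚP.*-zeroʳ (primeProduct f q) ⟩
    0ℚ                                        ∎
    where open ≡-Reasoning
  go {suc n} (≤′-step p≤′n) = begin
    primeProduct f (suc n)                    ≡⟨ primeProduct-suc f n ⟩
    primeProduct f n ℚ.* onPrimes f (suc n)   ≡⟨ cong (ℚ._* onPrimes f (suc n)) (go p≤′n) ⟩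
    0ℚ ℚ.* onPrimes f (suc n)                 ≡⟨ ℚP.*-zeroˡ (onPrimes f (suc n)) ⟩
    0ℚ                                        ∎
    where open ≡-Reasoning

½^n≤primeProduct : ∀ f → (∀ p → Prime p → ½ ℚ.≤ f p) → ∀ n → ½ ^ n ℚ.≤ primeProduct f n
½^n≤primeProduct f ½≤f zero    = ℚP.≤-refl
½^n≤primeProduct f ½≤f (suc n) = begin
  ½ ℚ.* ½ ^ n                               ≤⟨ ℚP.*-monoʳ-≤-nonNeg (½ ^ n) {{ℚ.nonNegative (ℚP.<⇒≤ (0<½^n n))}} ½≤g ⟩
  g ℚ.* ½ ^ n                               ≤⟨ ℚP.*-monoˡ-≤-nonNeg g {{ℚ.nonNegative (ℚP.≤-trans 0≤½ ½≤g)}} (½^n≤primeProduct f ½≤f n) ⟩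
  g ℚ.* primeProduct f n                    ≡⟨ ℚP.*-comm g _ ⟩
  primeProduct f n ℚ.* g                    ≡⟨ primeProduct-suc f n ⟨
  primeProduct f (suc n)                    ∎
  where
  open ℚP.≤-Reasoning
  g = onPrimes f (suc n)
  ½≤g : ½ ℚ.≤ g
  ½≤g = onPrimes-elim (½ ℚ.≤_) f (suc n) (½≤f (suc n)) ½≤1

telescope-step : ∀ {a A P P′} → 0ℚ ℚ.≤ a → A ℚ.* (1ℚ ℚ.+ a) ℚ.≤ a ℚ.* P →
                 ((1ℚ ℚ.+ a) ℚ.* (1ℚ ℚ.+ a) ℚ.- 1ℚ) ℚ.* P ℚ.≤ (1ℚ ℚ.+ a) ℚ.* (1ℚ ℚ.+ a) ℚ.* P′ →
                 A ℚ.* (1ℚ ℚ.+ (1ℚ ℚ.+ a)) ℚ.≤ (1ℚ ℚ.+ a) ℚ.* P′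
telescope-step {a} {A} {P} {P′} 0≤a A[1+a]≤aP step =
  ℚP.*-cancelˡ-≤-pos x {{ℚ.positive 0<x}} (begin
    x ℚ.* (A ℚ.* y)        ≡⟨ solve 3 (λ x y A → x :* (A :* y) := y :* (A :* x)) refl x y A ⟩
    y ℚ.* (A ℚ.* x)        ≤⟨ ℚP.*-monoˡ-≤-nonNeg y {{ℚ.nonNegative (ℚP.<⇒≤ 0<y)}} A[1+a]≤aP ⟩
    y ℚ.* (a ℚ.* P)        ≡⟨ solve 2 (λ a P → (con 1ℚ :+ (con 1ℚ :+ a)) :* (a :* P)
                                           := ((con 1ℚ :+ a) :* (con 1ℚ :+ a) :- con 1ℚ) :* P) refl a P ⟩
    (x ℚ.* x ℚ.- 1ℚ) ℚ.* P ≤⟨ step ⟩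
    x ℚ.* x ℚ.* P′         ≡⟨ ℚP.*-assoc x x P′ ⟩
    x ℚ.* (x ℚ.* P′)       ∎)
  where
  open ℚP.≤-Reasoning
  open +-*-Solver
  x = 1ℚ ℚ.+ a
  y = 1ℚ ℚ.+ x
  0<x : 0ℚ ℚ.< x
  0<x = ℚP.<-≤-trans 0<1 (p≤p+q 1ℚ 0≤a)
  0<y : 0ℚ ℚ.< y
  0<y = ℚP.<-≤-trans 0<1 (p≤p+q 1ℚ (ℚP.<⇒≤ 0<x))

-- The invariant is P (1 + a) · a / (1 + a) ≥ A; it survives a factor 1 - 1/x² at x = 1 + a
-- because (1 - 1/x²) · x / (x + 1) = (x - 1) / x.
telescope : ∀ (P : ℕ → ℚ) A a₀ →
            (∀ n → suc a₀ ≤ n → let x = ℕtoℚ n in (x ℚ.* x ℚ.- 1ℚ) ℚ.* P n ℚ.≤ x ℚ.* x ℚ.* P (suc n)) →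
            A ℚ.* ℕtoℚ (suc a₀) ℚ.≤ ℕtoℚ a₀ ℚ.* P (suc a₀) →
            ∀ {a} → a₀ ≤′ a → A ℚ.* ℕtoℚ (suc a) ℚ.≤ ℕtoℚ a ℚ.* P (suc a)
telescope P A a₀ step base ≤′-refl = base
telescope P A a₀ step base {suc a} (≤′-step a₀≤′a) =
  subst₂ (λ y x → A ℚ.* y ℚ.≤ x ℚ.* P (2 + a)) (sym y≡) (sym x≡)
    (telescope-step {A = A} (0≤ℕtoℚ a)
      (subst (λ x → A ℚ.* x ℚ.≤ ℕtoℚ a ℚ.* P (suc a)) x≡ (telescope P A a₀ step base a₀≤′a))
      (subst (λ x → (x ℚ.* x ℚ.- 1ℚ) ℚ.* P (suc a) ℚ.≤ x ℚ.* x ℚ.* P (2 + a)) x≡ (step (suc a) (s≤s (ℕP.≤′⇒≤ a₀≤′a)))))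
  where
  x≡ = ℕtoℚ-suc a
  y≡ = trans (ℕtoℚ-suc (suc a)) (cong (1ℚ ℚ.+_) x≡)

½-telescope-base : ∀ {a B P} → 1ℚ ℚ.≤ a → 0ℚ ℚ.≤ B → B ℚ.≤ P → (½ ℚ.* B) ℚ.* (1ℚ ℚ.+ a) ℚ.≤ a ℚ.* P
½-telescope-base {a} {B} {P} 1≤a 0≤B B≤P = begin
  (½ ℚ.* B) ℚ.* (1ℚ ℚ.+ a)                              ≤⟨ p≤p+q _ (0≤-*-0≤ (0≤-*-0≤ 0≤½ 0≤B) 0≤a-1) ⟩
  (½ ℚ.* B) ℚ.* (1ℚ ℚ.+ a) ℚ.+ (½ ℚ.* B) ℚ.* (a ℚ.- 1ℚ)
    ≡⟨ solve 2 (λ B a → (con ½ :* B) :* (con 1ℚ :+ a) :+ (con ½ :* B) :* (a :- con 1ℚ) := a :* B) refl B a ⟩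
  a ℚ.* B                                               ≤⟨ ℚP.*-monoˡ-≤-nonNeg a {{ℚ.nonNegative (ℚP.≤-trans 0≤1 1≤a)}} B≤P ⟩
  a ℚ.* P                                               ∎
  where
  open ℚP.≤-Reasoning
  open +-*-Solver
  0≤a-1 : 0ℚ ℚ.≤ a ℚ.- 1ℚ
  0≤a-1 = ℚP.+-monoˡ-≤ (ℚ.- 1ℚ) 1≤a

telescope-end : ∀ {a A P} → 0ℚ ℚ.< a → 0ℚ ℚ.≤ A → A ℚ.* (1ℚ ℚ.+ a) ℚ.≤ a ℚ.* P → A ℚ.≤ P
telescope-end {a} {A} {P} 0<a 0≤A A[1+a]≤aP = ℚP.*-cancelˡ-≤-pos a {{ℚ.positive 0<a}} (begin
  a ℚ.* A                 ≤⟨ p≤p+q (a ℚ.* A) 0≤A ⟩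
  a ℚ.* A ℚ.+ A           ≡⟨ solve 2 (λ a A → a :* A :+ A := A :* (con 1ℚ :+ a)) refl a A ⟩
  A ℚ.* (1ℚ ℚ.+ a)        ≤⟨ A[1+a]≤aP ⟩
  a ℚ.* P                 ∎)
  where
  open ℚP.≤-Reasoning
  open +-*-Solver

primeProduct-lowerBound : ∀ f s → (∀ p → Prime p → ½ ℚ.≤ f p) →
  (∀ r → suc s ≤ r → Prime (2 + r) → let x = ℕtoℚ (suc r) in x ℚ.* x ℚ.- 1ℚ ℚ.≤ x ℚ.* x ℚ.* f (2 + r)) →
  ∀ n → 2 + s ≤ n → ½ ^ (3 + s) ℚ.≤ primeProduct f n
primeProduct-lowerBound f s ½≤f large (suc (suc a)) (s≤s (s≤s s≤a)) =
  telescope-end (0<ℕtoℚ a) (ℚP.<⇒≤ (0<½^n (3 + s)))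
    (subst (λ y → ½ ^ (3 + s) ℚ.* y ℚ.≤ ℕtoℚ (suc a) ℚ.* P (2 + a)) (ℕtoℚ-suc (suc a))
      (telescope P (½ ^ (3 + s)) (suc s) step base (ℕP.≤⇒≤′ (s≤s s≤a))))
  where
  P = primeProduct f
  0≤P : ∀ n → 0ℚ ℚ.≤ P n
  0≤P n = ℚP.≤-trans (ℚP.<⇒≤ (0<½^n n)) (½^n≤primeProduct f ½≤f n)
  base : ½ ^ (3 + s) ℚ.* ℕtoℚ (2 + s) ℚ.≤ ℕtoℚ (suc s) ℚ.* P (2 + s)
  base = subst (λ y → ½ ^ (3 + s) ℚ.* y ℚ.≤ ℕtoℚ (suc s) ℚ.* P (2 + s)) (sym (ℕtoℚ-suc (suc s)))
           (½-telescope-base (subst (1ℚ ℚ.≤_) (sym (ℕtoℚ-suc s)) (p≤p+q 1ℚ (0≤ℕtoℚ s)))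
                             (ℚP.<⇒≤ (0<½^n (2 + s))) (½^n≤primeProduct f ½≤f (2 + s)))
  step : ∀ n → 2 + s ≤ n → let x = ℕtoℚ n in (x ℚ.* x ℚ.- 1ℚ) ℚ.* P n ℚ.≤ x ℚ.* x ℚ.* P (suc n)
  step n@(suc r) (s≤s s<r) = begin
    (x ℚ.* x ℚ.- 1ℚ) ℚ.* P n    ≤⟨ ℚP.*-monoʳ-≤-nonNeg (P n) {{ℚ.nonNegative (0≤P n)}} x²-1≤x²g ⟩
    (x ℚ.* x ℚ.* g) ℚ.* P n     ≡⟨ solve 3 (λ x g P → (x :* x :* g) :* P := x :* x :* (P :* g)) refl x g (P n) ⟩
    x ℚ.* x ℚ.* (P n ℚ.* g)     ≡⟨ cong (x ℚ.* x ℚ.*_) (primeProduct-suc f n) ⟨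
    x ℚ.* x ℚ.* P (suc n)       ∎
    where
    open ℚP.≤-Reasoning
    open +-*-Solver
    x = ℕtoℚ n
    g = onPrimes f (suc n)
    x²-1≤x²g : x ℚ.* x ℚ.- 1ℚ ℚ.≤ x ℚ.* x ℚ.* g
    x²-1≤x²g = onPrimes-elim (λ g → x ℚ.* x ℚ.- 1ℚ ℚ.≤ x ℚ.* x ℚ.* g) f (suc n) (large r s<r)
                 (subst (x ℚ.* x ℚ.- 1ℚ ℚ.≤_) (sym (ℚP.*-identityʳ _)) (p-q≤p (x ℚ.* x) 0≤1))

SZero-if-localFactor≡0 : ∀ {m p N} (c : Fin m → ℕ) → Prime p → localFactor c N p ≡ 0ℚ → SZero c N
SZero-if-localFactor≡0 {p = p} {N} c pp localFactor≡0 ε 0<ε = p , λ X p≤X →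
  subst (λ v → ℚ.∣ v ∣ ℚ.≤ ε) (sym (primeProduct≡0 (localFactor c N) pp localFactor≡0 p≤X)) (ℚP.<⇒≤ 0<ε)

SGeq-if-eventually≥ : ∀ {m N X₀ κ} (c : Fin m → ℕ) → (∀ X → X₀ ≤ X → κ ℚ.≤ partialS c N X) → SGeq c N κ
SGeq-if-eventually≥ {X₀ = X₀} {κ} c κ≤ ε 0<ε = X₀ , λ X X₀≤X → ℚP.≤-trans (p-q≤p κ (ℚP.<⇒≤ 0<ε)) (κ≤ X X₀≤X)

¬SZero-if-eventually≥ : ∀ {m N X₀ κ} (c : Fin m → ℕ) → 0ℚ <ℚ κ → (∀ X → X₀ ≤ X → κ ℚ.≤ partialS c N X) → ¬ SZero c N
¬SZero-if-eventually≥ {N = N} {X₀} {κ} c 0<κ κ≤ SZero-cN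
  with SZero-cN (κ ℚ.* ½) (ℚP.positive⁻¹ _ {{ℚP.pos*pos⇒pos κ {{ℚ.positive 0<κ}} ½}})
... | X₁ , small = ℚP.<-irrefl refl (begin-strict
  κ                           ≤⟨ κ≤ X (ℕP.m≤m⊔n X₀ X₁) ⟩
  partialS c N X              ≤⟨ p≤∣p∣ _ ⟩
  ℚ.∣ partialS c N X ∣        ≤⟨ small X (ℕP.m≤n⊔m X₀ X₁) ⟩
  κ ℚ.* ½                     <⟨ ℚP.*-monoʳ-<-pos κ {{ℚ.positive 0<κ}} ½<1 ⟩
  κ ℚ.* 1ℚ                    ≡⟨ ℚP.*-identityʳ κ ⟩
  κ                           ∎)
  where
  open ℚP.≤-Reasoning
  X = X₀ ⊔ X₁

partialS-lowerBound : ∀ {m N} (c : Fin m → ℕ) → 3 ≤ m → (∀ i → 0 < c i) → gcdAll c ≡ 1 → 2 ∣ sumFin c + N →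
                      (∀ i → gcdAll (replaceAt c i N) ≡ 1) → ∀ X → 2 + sumFin c ≤ X → ½ ^ (3 + sumFin c) ℚ.≤ partialS c N X
partialS-lowerBound {N = N} c 3≤m 0<c gcd≡1 2∣S+N coprime =
  primeProduct-lowerBound (localFactor c N) (sumFin c) (λ p → ½≤localFactor c gcd≡1 2∣S+N coprime)
    λ r S<r pp → localFactor-large c N 3≤m pp λ i p∣c →
      ℕP.<⇒≱ (ℕP.≤-trans S<r (ℕP.m≤n+m r 2)) (ℕP.≤-trans (∣⇒≤ {{ℕ.>-nonZero (0<c i)}} p∣c) (≤sumFin c i))

parity-necessary : ∀ {m N} (c : Fin m → ℕ) → gcdAll c ≡ 1 → ¬ SZero c N → 2 ∣ sumFin c + N
parity-necessary {N = N} c gcd≡1 ¬SZero = decidable-stable (2 ∣? sumFin c + N) λ 2∤S+N →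
  ¬SZero (SZero-if-localFactor≡0 c prime[2] (localFactor₂≡0 c N gcd≡1 2∤S+N))

coprime-necessary : ∀ {m N} (c : Fin m → ℕ) → 0 < N → gcdAll c ≡ 1 → ¬ SZero c N → ∀ i → gcdAll (replaceAt c i N) ≡ 1
coprime-necessary {N = N} c 0<N gcd≡1 ¬SZero i = decidable-stable (g ℕ.≟ 1) λ g≢1 →
  let p , pp , p∣g = ∃prime∣ g≢0 g≢1 in ¬SZero (SZero-if-localFactor≡0 c pp (localFactor≡0 c i pp gcd≡1 p∣g))
  where
  g = gcdAll (replaceAt c i N)
  g≢0 : g ≢ 0
  g≢0 g≡0 = ℕP.<-irrefl (sym (0∣⇒≡0 (subst (_∣ N) g≡0 (proj₁ (∣-gcdAll-replaceAt⁻ c i ∣-refl))))) 0<N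

lemma2p2 : (m : ℕ) → 3 ≤ m → (c : Fin m → ℕ) → (∀ i → 0 < c i) → gcdAll c ≡ 1 →
  ((N : ℕ) → 0 < N →
    ((¬ SZero c N) ⇔ ((2 ∣ (sumFin c + N)) × (∀ i → gcdAll (replaceAt c i N) ≡ 1))))
  × (∃ λ (κ : ℚ) → (0ℚ <ℚ κ) × ((N : ℕ) → 0 < N → ¬ SZero c N → SGeq c N κ))
lemma2p2 m 3≤m c 0<c gcd≡1 =
    (λ N 0<N → mk⇔ (λ ¬SZero → necessary 0<N ¬SZero)
                   (λ (2∣S+N , coprime) → ¬SZero-if-eventually≥ c 0<κ (lowerBound 2∣S+N coprime)))
  , κ , 0<κ
  , λ N 0<N ¬SZero → let 2∣S+N , coprime = necessary 0<N ¬SZero in SGeq-if-eventually≥ c (lowerBound 2∣S+N coprime)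
  where
  κ = ½ ^ (3 + sumFin c)
  0<κ = 0<½^n (3 + sumFin c)
  lowerBound = λ {N} → partialS-lowerBound {N = N} c 3≤m 0<c gcd≡1
  necessary : ∀ {N} → 0 < N → ¬ SZero c N → 2 ∣ sumFin c + N × (∀ i → gcdAll (replaceAt c i N) ≡ 1)
  necessary 0<N ¬SZero = parity-necessary c gcd≡1 ¬SZero , coprime-necessary c 0<N gcd≡1 ¬SZero
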